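{- For any tree $T$ with at least four vertices, $\mu(T)\le\mu'(T)$, with equality only when $T$ is the path $P_4$ on four vertices.
   Context: A subtree of $T$ is a nonempty subset $S\subseteq V(T)$ inducing a connected subgraph; $\mathcal{S}(T)$ is the set of subtrees. A leaf is a vertex of degree at most $1$. $\mathcal{S}'(T)$ is obtained from $\mathcal{S}(T)$ by adding the empty set and removing the singleton $\{v\}$ for every leaf $v$ of $T$ (singletons of non-leaves remain). $\mu(T)$ is the average of $|S|$ over $S\in\mathcal{S}(T)$, and $\mu'(T)$ is the average of $|S|$ over $S\in\mathcal{S}'(T)$. -}

module Defs where

open import Data.Nat using (ℕ; zero; suc; _+_; _≤_; _≡ᵇ_)
open import Data.Bool using (Bool; true; false; _∨_)
open import Data.Fin using (Fin; toℕ)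
open import Data.Fin.Subset using (Subset; _∈_; Nonempty; ⁅_⁆; ∣_∣) renaming (⊥ to ∅)
open import Data.Vec using (tabulate)
open import Data.List using (List; []; _∷_; _++_; [_]; length; map)
open import Data.Nat.ListAction using (sum)
open import Data.List.Relation.Unary.Unique.Propositional using (Unique)
open import Data.List.Relation.Unary.Linked using (Linked)
open import Data.List.Membership.Propositional renaming (_∈_ to _∈ₗ_)
open import Data.Integer using (+_)
open import Data.Rational using (ℚ; _/_) renaming (0ℚ to zeroℚ)
open import Data.Product using (Σ; ∃; _×_; _,_)
open import Data.Sum using (_⊎_)
open import Relation.Binary.PropositionalEquality using (_≡_)
open import Relation.Nullary using (¬_)
open import Function.Bundles using (_↔_; Inverse)

record Graph (n : ℕ) : Set where
  field
    E      : Fin n → Fin n → Bool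
    sym    : ∀ u v → E u v ≡ E v u
    irrefl : ∀ u → E u u ≡ false
open Graph public

Adj : ∀ {n} → Graph n → Fin n → Fin n → Set
Adj G u v = E G u v ≡ true

data Reach {n} (G : Graph n) (S : Subset n) (u : Fin n) : Fin n → Set where
  here : u ∈ S → Reach G S u u
  step : ∀ {v w} → Reach G S u v → Adj G v w → w ∈ S → Reach G S u w

InducesConnected : ∀ {n} → Graph n → Subset n → Set
InducesConnected {n} G S = ∀ (u v : Fin n) → u ∈ S → v ∈ S → Reach G S u v

Connected : ∀ {n} → Graph n → Set
Connected {n} G = ∀ (u v : Fin n) → Reach G (Data.Vec.replicate n true) u v
  where import Data.Vec

HasCycle : ∀ {n} → Graph n → Set
HasCycle {n} G =
  Σ (Fin n) λ v → Σ (List (Fin n)) λ ws → Σ (Fin n) λ w →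
    (1 ≤ length ws) × Unique (v ∷ ws ++ [ w ]) ×
    Linked (Adj G) (v ∷ ws ++ [ w ]) × Adj G w v

IsTree : ∀ {n} → Graph n → Set
IsTree {n} G = (1 ≤ n) × Connected G × ¬ HasCycle G

degree : ∀ {n} → Graph n → Fin n → ℕ
degree G v = ∣ tabulate (E G v) ∣

IsLeaf : ∀ {n} → Graph n → Fin n → Set
IsLeaf G v = degree G v ≤ 1

IsSubtree : ∀ {n} → Graph n → Subset n → Set
IsSubtree G S = Nonempty S × InducesConnected G S

IsSubtree' : ∀ {n} → Graph n → Subset n → Set
IsSubtree' {n} G S =
  (S ≡ ∅ ⊎ IsSubtree G S) × ¬ (Σ (Fin n) λ v → IsLeaf G v × S ≡ ⁅ v ⁆)

Enumerates : ∀ {n} → List (Subset n) → (Subset n → Set) → Set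
Enumerates {n} L P = Unique L × (∀ (S : Subset n) → (S ∈ₗ L → P S) × (P S → S ∈ₗ L))

average : List ℕ → ℚ
average [] = zeroℚ
average (x ∷ xs) = (+ sum (x ∷ xs)) / suc (length xs)

avgSize : ∀ {n} → List (Subset n) → ℚ
avgSize L = average (map ∣_∣ L)

-- the path P4 : 0 - 1 - 2 - 3
P4 : Graph 4
P4 = record { E = λ i j → ((suc (toℕ i)) ≡ᵇ toℕ j) ∨ ((suc (toℕ j)) ≡ᵇ toℕ i)
            ; sym = sy ; irrefl = ir }
  where
  open import Data.Fin using (zero; suc)
  open import Relation.Binary.PropositionalEquality using (refl)
  sy : ∀ (u v : Fin 4) → _ ≡ _
  sy zero zero = refl
  sy zero (suc zero) = refl
  sy zero (suc (suc zero)) = refl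
  sy zero (suc (suc (suc zero))) = refl
  sy (suc zero) zero = refl
  sy (suc zero) (suc zero) = refl
  sy (suc zero) (suc (suc zero)) = refl
  sy (suc zero) (suc (suc (suc zero))) = refl
  sy (suc (suc zero)) zero = refl
  sy (suc (suc zero)) (suc zero) = refl
  sy (suc (suc zero)) (suc (suc zero)) = refl
  sy (suc (suc zero)) (suc (suc (suc zero))) = refl
  sy (suc (suc (suc zero))) zero = refl
  sy (suc (suc (suc zero))) (suc zero) = refl
  sy (suc (suc (suc zero))) (suc (suc zero)) = refl
  sy (suc (suc (suc zero))) (suc (suc (suc zero))) = refl
  ir : ∀ (u : Fin 4) → _ ≡ false
  ir zero = refl
  ir (suc zero) = refl
  ir (suc (suc zero)) = refl
  ir (suc (suc (suc zero))) = refl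

Isomorphic : ∀ {n m} → Graph n → Graph m → Set
Isomorphic {n} {m} G H =
  Σ (Fin n ↔ Fin m) λ f → ∀ u v → E G u v ≡ E H (Inverse.to f u) (Inverse.to f v)

-- Split the subtrees of T into the k leaf singletons and the r others, of total size t.
-- Then μ = (k + t) / (k + r) while μ′ = t / (r + 1), because 𝒮′ consists of ∅ and those r
-- subtrees; after cross-multiplying, μ ≤ μ′ reads k (r + 1) + t ≤ k t.  This holds as soon
-- as k ≥ 2 and t ≥ 2r + 2, and is then an equality only for k = 2 and t = 2r + 2.
-- A tree has two leaves x, z, so k ≥ 2.  Among the r subtrees the singletons, which belong
-- to non-leaves, number at most n − 2; all others have at least two vertices, and T, T − x,
-- T − z have n, n − 1, n − 1.  Hence t ≥ 2r + 2n − 6 ≥ 2r + 2.  In the equality case n = 4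
-- and x, z are the only leaves, which makes the path between them span T, so T ≅ P4.
module Submission where

open import Defs hiding (sym)
open import Data.Nat using (ℕ; zero; suc; _+_; _*_; _∸_; _≤_; z≤n; s≤s)
import Data.Nat as ℕ
open import Data.Nat.Properties
open import Data.Nat.ListAction using (sum)
open import Data.Nat.ListAction.Properties using (sum-++; sum-↭)
open import Data.List using (List; []; _∷_; _++_; [_]; length; map; filter; allFin; lookup)
open import Data.List.Properties using (map-++; length-++; length-map; length-tabulate; ++-assoc)
open import Data.List.Relation.Unary.All as All using ([]; _∷_)
open import Data.List.Relation.Unary.All.Properties using (++⁻ˡ; ¬Any⇒All¬)
open import Data.List.Relation.Unary.Linked using (Linked; []; [-]; _∷_)
open import Data.List.Relation.Unary.Any using (here; there; index)
open import Data.List.Relation.Unary.Any.Properties using (lookup-index)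
open import Data.List.Relation.Unary.AllPairs using ([]; _∷_)
open import Data.List.Relation.Unary.Unique.Propositional using (Unique)
open import Data.List.Relation.Unary.Unique.Propositional.Properties using (allFin⁺; filter⁺)
import Data.List.Relation.Unary.Unique.Propositional.Properties as Unique
open import Data.List.Membership.Propositional using (_∈_; _∉_)
open import Data.List.Membership.Propositional.Properties using (∈-∃++; ∈-allFin; ∈-lookup; ∈-filter⁺; ∈-filter⁻; ∈-map⁻; ∈-map⁺)
open import Data.List.Membership.Propositional.Properties.WithK using (unique∧set⇒bag)
open import Data.List.Relation.Binary.BagAndSetEquality using (∼bag⇒↭)
open import Data.List.Relation.Binary.Permutation.Propositional using (_↭_; prep; ↭-trans; ↭-sym)
open import Data.List.Relation.Binary.Permutation.Propositional.Properties using (shift; map⁺; ↭-length)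
open import Data.Fin using (Fin; zero; suc)
open import Data.Fin.Patterns using (0F; 1F; 2F; 3F)
import Data.Fin.Properties as Fin
open import Data.Fin.Subset using (Subset; ⁅_⁆; ∣_∣; ⊤; ∁) renaming (⊥ to ∅; _∈_ to _∈ₛ_)
open import Data.Fin.Subset.Properties
  using (x∈p⇒∣p-x∣<∣p∣; x∈p∧x≢y⇒x∈p-y; nonempty?; Empty-unique; p⊆q⇒∣p∣≤∣q∣; ∣⁅x⁆∣≡1; x∈⁅x⁆; x∈⁅y⁆⇒x≡y; ∣⊥∣≡0;
         x∉p⇒x∈∁p; x≢y⇒x∉⁅y⁆; x∉⁅y⁆⇒x≢y; x∈∁p⇒x∉p; ∈⊤; ∉⊥; ∣⊤∣≡n; ∣∁p∣≡n∸∣p∣)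
open import Data.Vec using (_∷_; tabulate)
open import Data.Vec.Properties using (lookup⇒[]=; []=⇒lookup; lookup∘tabulate; ≡-dec)
open import Data.Bool using (true; false)
import Data.Bool as Bool
open import Data.Bool.Properties using (¬-not)
open import Data.Product using (Σ; ∃; _×_; _,_; proj₁; proj₂; uncurry)
open import Data.Sum using (_⊎_; inj₁; inj₂)
open import Data.Empty using (⊥-elim)
open import Relation.Nullary using (¬_; yes; no; ¬?; _×-dec_)
open import Relation.Unary using (Decidable)
open import Relation.Unary.Properties using (∁?)
open import Relation.Binary.PropositionalEquality hiding ([_])
import Data.Integer as ℤ
import Data.Integer.Properties as ℤ
open import Data.Rational using (_/_) renaming (_≤_ to _≤ℚ_)
import Data.Rational.Properties as ℚ
open import Data.Rational.Unnormalised using (mkℚᵘ; *≤*)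
import Data.Rational.Unnormalised.Properties as ℚᵘ
open import Data.Nat.Tactic.RingSolver using (solve-∀)
open import Function using (_∘_; case_of_)
open import Function.Bundles using (mk↔ₛ′; mk⇔)
open import Algebra.Properties.CommutativeSemigroup +-commutativeSemigroup using (x∙yz≈y∙xz; interchange)

module _ {A : Set} where

  infix 4 _⊆_
  _⊆_ : List A → List A → Set
  xs ⊆ ys = ∀ {a} → a ∈ xs → a ∈ ys

  ∈-++-∷⁻ : ∀ {a x : A} pre post → a ∈ pre ++ x ∷ post → a ≢ x → a ∈ pre ++ post
  ∈-++-∷⁻ []        post (here a≡x)  a≢x = ⊥-elim (a≢x a≡x)
  ∈-++-∷⁻ []        post (there a∈)  _   = a∈
  ∈-++-∷⁻ (p ∷ pre) post (here a≡p)  _   = here a≡p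
  ∈-++-∷⁻ (p ∷ pre) post (there a∈)  a≢x = there (∈-++-∷⁻ pre post a∈ a≢x)

  sum-map-++ : (f : A → ℕ) (xs ys : List A) → sum (map f (xs ++ ys)) ≡ sum (map f xs) + sum (map f ys)
  sum-map-++ f xs ys = trans (cong sum (map-++ f xs ys)) (sum-++ (map f xs) (map f ys))

  Unique⇒sum-map-mono : (f : A → ℕ) {xs ys : List A} → Unique xs → xs ⊆ ys →
                         sum (map f xs) ≤ sum (map f ys)
  Unique⇒sum-map-mono f {[]}     _            _  = z≤n
  Unique⇒sum-map-mono f {x ∷ xs} (x∉xs ∷ uxs) xs⊆ys with ∈-∃++ (xs⊆ys (here refl))
  ... | pre , post , refl = begin
    f x + sum (map f xs)                         ≤⟨ +-monoʳ-≤ (f x) ih ⟩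
    f x + sum (map f (pre ++ post))              ≡⟨ cong (f x +_) (sum-map-++ f pre post) ⟩
    f x + (sum (map f pre) + sum (map f post))   ≡⟨ x∙yz≈y∙xz (f x) (sum (map f pre)) _ ⟩
    sum (map f pre) + (f x + sum (map f post))   ≡⟨ sum-map-++ f pre (x ∷ post) ⟨
    sum (map f (pre ++ x ∷ post))                ∎
    where
    open ≤-Reasoning
    ih : sum (map f xs) ≤ sum (map f (pre ++ post))
    ih = Unique⇒sum-map-mono f uxs λ a∈xs →
           ∈-++-∷⁻ pre post (xs⊆ys (there a∈xs)) (λ a≡x → All.lookup x∉xs a∈xs (sym a≡x))

  sum-map-const : (f : A → ℕ) {c : ℕ} (xs : List A) → (∀ {a} → a ∈ xs → f a ≡ c) → sum (map f xs) ≡ length xs * c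
  sum-map-const f []       _   = refl
  sum-map-const f (x ∷ xs) f≡c = cong₂ _+_ (f≡c (here refl)) (sum-map-const f xs (f≡c ∘ there))

  Unique⇒length-mono : {xs ys : List A} → Unique xs → xs ⊆ ys → length xs ≤ length ys
  Unique⇒length-mono {xs} {ys} uxs xs⊆ys =
    subst₂ _≤_ (length*1 xs) (length*1 ys) (Unique⇒sum-map-mono (λ _ → 1) uxs xs⊆ys)
    where
    length*1 : ∀ zs → sum (map (λ _ → 1) zs) ≡ length zs
    length*1 zs = trans (sum-map-const (λ _ → 1) zs (λ _ → refl)) (*-identityʳ (length zs))

  sum-map-∸ : (f : A → ℕ) {c : ℕ} (xs : List A) → (∀ {a} → a ∈ xs → c ≤ f a) →
              sum (map f xs) ≡ length xs * c + sum (map (λ a → f a ∸ c) xs)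
  sum-map-∸ f []       _   = refl
  sum-map-∸ f {c} (x ∷ xs) c≤f = begin
    f x + sum (map f xs)                                   ≡⟨ cong₂ _+_ (sym (m+[n∸m]≡n (c≤f (here refl)))) (sum-map-∸ f xs (c≤f ∘ there)) ⟩
    c + (f x ∸ c) + (length xs * c + sum (map g xs))      ≡⟨ interchange c _ _ _ ⟩
    c + length xs * c + ((f x ∸ c) + sum (map g xs))      ∎
    where
    open ≡-Reasoning
    g : A → ℕ
    g a = f a ∸ c

  ↭-filter-∁ : {P : A → Set} (P? : Decidable P) (xs : List A) → xs ↭ filter P? xs ++ filter (∁? P?) xs
  ↭-filter-∁ P? []       = _↭_.refl
  ↭-filter-∁ P? (x ∷ xs) with P? x
  ... | yes _ = prep x (↭-filter-∁ P? xs)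
  ... | no  _ = ↭-trans (prep x (↭-filter-∁ P? xs)) (↭-sym (shift x (filter P? xs) (filter (∁? P?) xs)))

  Unique⇒lookup-injective : ∀ {xs : List A} → Unique xs → ∀ {i j} → lookup xs i ≡ lookup xs j → i ≡ j
  Unique⇒lookup-injective {x ∷ xs} _            {zero}  {zero}  _ = refl
  Unique⇒lookup-injective {x ∷ xs} (x∉xs ∷ _)   {zero}  {suc j} x≡ = ⊥-elim (All.lookup x∉xs (∈-lookup j) x≡)
  Unique⇒lookup-injective {x ∷ xs} (x∉xs ∷ _)   {suc i} {zero}  ≡x = ⊥-elim (All.lookup x∉xs (∈-lookup i) (sym ≡x))
  Unique⇒lookup-injective {x ∷ xs} (_ ∷ uxs)    {suc i} {suc j} eq = cong suc (Unique⇒lookup-injective uxs eq)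

  Unique-++⁻ˡ : ∀ xs {ys : List A} → Unique (xs ++ ys) → Unique xs
  Unique-++⁻ˡ []       _            = []
  Unique-++⁻ˡ (x ∷ xs) (x∉ ∷ uxys) = ++⁻ˡ xs x∉ ∷ Unique-++⁻ˡ xs uxys

  Linked-++⁻ˡ : ∀ {R : A → A → Set} xs {ys : List A} → Linked R (xs ++ ys) → Linked R xs
  Linked-++⁻ˡ []           _         = []
  Linked-++⁻ˡ (x ∷ [])     _         = [-]
  Linked-++⁻ˡ (x ∷ y ∷ xs) (r ∷ rs)  = r ∷ Linked-++⁻ˡ (y ∷ xs) rs

module _ {n : ℕ} where

  Unique⇒length≤ : {xs : List (Fin n)} → Unique xs → length xs ≤ n
  Unique⇒length≤ {xs} uxs = subst (length xs ≤_) (length-tabulate (λ i → i))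
                              (Unique⇒length-mono uxs (λ {a} _ → ∈-allFin a))

  Unique-covering⇒length≡ : {xs : List (Fin n)} → Unique xs → (∀ a → a ∈ xs) → length xs ≡ n
  Unique-covering⇒length≡ {xs} uxs cover = ≤-antisym (Unique⇒length≤ uxs)
    (subst (_≤ length xs) (length-tabulate (λ i → i)) (Unique⇒length-mono (allFin⁺ n) (λ {a} _ → cover a)))

module _ {n : ℕ} where

  ∈⇒1≤∣p∣ : {p : Subset n} {x : Fin n} → x ∈ₛ p → 1 ≤ ∣ p ∣
  ∈⇒1≤∣p∣ x∈p = ≤-trans (s≤s z≤n) (x∈p⇒∣p-x∣<∣p∣ x∈p)

  ∈∧∈∧≢⇒2≤∣p∣ : {p : Subset n} {x y : Fin n} → x ∈ₛ p → y ∈ₛ p → x ≢ y → 2 ≤ ∣ p ∣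
  ∈∧∈∧≢⇒2≤∣p∣ x∈p y∈p x≢y =
    ≤-trans (s≤s (∈⇒1≤∣p∣ (x∈p∧x≢y⇒x∈p-y y∈p (x≢y ∘ sym)))) (x∈p⇒∣p-x∣<∣p∣ x∈p)

  ∣p∣≤1 : {p : Subset n} → (∀ {x y} → x ∈ₛ p → y ∈ₛ p → x ≡ y) → ∣ p ∣ ≤ 1
  ∣p∣≤1 {p} all-equal with nonempty? p
  ... | yes (x , x∈p) = subst (∣ p ∣ ≤_) (∣⁅x⁆∣≡1 x)
          (p⊆q⇒∣p∣≤∣q∣ λ y∈p → subst (_∈ₛ ⁅ x ⁆) (all-equal x∈p y∈p) (x∈⁅x⁆ x))
  ... | no  empty     = subst (λ q → ∣ q ∣ ≤ 1) (sym (Empty-unique empty)) (≤-trans (≤-reflexive (∣⊥∣≡0 n)) z≤n)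

  ≢⇒∈∁⁅⁆ : {x y : Fin n} → x ≢ y → x ∈ₛ ∁ ⁅ y ⁆
  ≢⇒∈∁⁅⁆ x≢y = x∉p⇒x∈∁p (x≢y⇒x∉⁅y⁆ x≢y)

  ∈∁⁅⁆⇒≢ : {x y : Fin n} → x ∈ₛ ∁ ⁅ y ⁆ → x ≢ y
  ∈∁⁅⁆⇒≢ x∈ = x∉⁅y⁆⇒x≢y (x∈∁p⇒x∉p x∈)

  ∣p∣≡0⇒p≡⊥ : {p : Subset n} → ∣ p ∣ ≡ 0 → p ≡ ∅
  ∣p∣≡0⇒p≡⊥ ∣p∣≡0 = Empty-unique λ (_ , x∈p) → 1+n≰n (subst (1 ≤_) ∣p∣≡0 (∈⇒1≤∣p∣ x∈p))

∣p∣≡1⇒p≡⁅x⁆ : ∀ {n} (p : Subset n) → ∣ p ∣ ≡ 1 → ∃ λ x → p ≡ ⁅ x ⁆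
∣p∣≡1⇒p≡⁅x⁆ (true  ∷ p) ∣p∣≡1 = zero , cong (true ∷_) (∣p∣≡0⇒p≡⊥ (suc-injective ∣p∣≡1))
∣p∣≡1⇒p≡⁅x⁆ (false ∷ p) ∣p∣≡1 with ∣p∣≡1⇒p≡⁅x⁆ p ∣p∣≡1
... | x , refl = suc x , refl

⁅⁆-injective : ∀ {n} {x y : Fin n} → ⁅ x ⁆ ≡ ⁅ y ⁆ → x ≡ y
⁅⁆-injective {y = y} ⁅x⁆≡⁅y⁆ = x∈⁅y⁆⇒x≡y y (subst (_ ∈ₛ_) ⁅x⁆≡⁅y⁆ (x∈⁅x⁆ _))

⊤≢∁⁅x⁆ : ∀ {n} {x : Fin n} → ⊤ ≢ ∁ ⁅ x ⁆
⊤≢∁⁅x⁆ {x = x} ⊤≡∁⁅x⁆ = ∈∁⁅⁆⇒≢ (subst (x ∈ₛ_) ⊤≡∁⁅x⁆ ∈⊤) refl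

∁⁅⁆-injective : ∀ {n} {x y : Fin n} → ∁ ⁅ x ⁆ ≡ ∁ ⁅ y ⁆ → x ≡ y
∁⁅⁆-injective {x = x} {y} ∁⁅x⁆≡∁⁅y⁆ with x Fin.≟ y
... | yes x≡y = x≡y
... | no  x≢y = ⊥-elim (∈∁⁅⁆⇒≢ (subst (y ∈ₛ_) ∁⁅x⁆≡∁⁅y⁆ (≢⇒∈∁⁅⁆ (x≢y ∘ sym))) refl)

Unique-singletons⇒length≤ : ∀ {n} {ps : List (Subset n)} → Unique ps → (∀ {p} → p ∈ ps → ∣ p ∣ ≡ 1) → length ps ≤ n
Unique-singletons⇒length≤ {n} {ps} unique singleton =
  subst (length ps ≤_) (trans (length-map ⁅_⁆ (allFin n)) (length-tabulate (λ i → i)))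
    (Unique⇒length-mono unique λ {p} p∈ → case ∣p∣≡1⇒p≡⁅x⁆ p (singleton p∈) of λ where
      (v , refl) → ∈-map⁺ ⁅_⁆ (∈-allFin v))

-- Graphs: leaves, walks and paths

module _ {n : ℕ} (G : Graph n) where

  open import Data.List.Membership.DecPropositional (Fin._≟_ {n}) using (_∈?_)

  neighbours : Fin n → Subset n
  neighbours v = tabulate (E G v)

  Adj⇒∈neighbours : ∀ {v u} → Adj G v u → u ∈ₛ neighbours v
  Adj⇒∈neighbours {v} {u} vu = lookup⇒[]= u _ (trans (lookup∘tabulate (E G v) u) vu)

  ∈neighbours⇒Adj : ∀ {v u} → u ∈ₛ neighbours v → Adj G v u
  ∈neighbours⇒Adj {v} {u} u∈ = trans (sym (lookup∘tabulate (E G v) u)) ([]=⇒lookup u∈)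

  Adj⇒≢ : ∀ {u v} → Adj G u v → u ≢ v
  Adj⇒≢ {u} uv refl with trans (sym uv) (irrefl G u)
  ... | ()

  Adj-sym : ∀ {u v} → Adj G u v → Adj G v u
  Adj-sym {u} {v} uv = trans (Graph.sym G v u) uv

  leaf⇒Adj-unique : ∀ {x a b} → IsLeaf G x → Adj G x a → Adj G x b → a ≡ b
  leaf⇒Adj-unique {a = a} {b} leaf xa xb with a Fin.≟ b
  ... | yes a≡b = a≡b
  ... | no  a≢b = ⊥-elim (1+n≰n (≤-trans (∈∧∈∧≢⇒2≤∣p∣ (Adj⇒∈neighbours xa) (Adj⇒∈neighbours xb) a≢b) leaf))

  Adj-unique⇒leaf : ∀ {x} → (∀ {a b} → Adj G x a → Adj G x b → a ≡ b) → IsLeaf G x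
  Adj-unique⇒leaf unique = ∣p∣≤1 λ a∈ b∈ → unique (∈neighbours⇒Adj a∈) (∈neighbours⇒Adj b∈)

  Reach⇒Adj-last : ∀ {S u w} → Reach G S u w → u ≢ w → ∃ λ v → Adj G v w
  Reach⇒Adj-last (here _)          u≢u = ⊥-elim (u≢u refl)
  Reach⇒Adj-last (step {v} _ vw _) _   = v , vw

  -- Induction invariant: a walk starting off the leaf x can only enter x at its last step.
  Reach-avoiding-leaf : ∀ {x u v} → IsLeaf G x → Reach G ⊤ u v → u ≢ x →
    (v ≢ x → Reach G (∁ ⁅ x ⁆) u v) × (v ≡ x → ∃ λ q → Adj G q x × Reach G (∁ ⁅ x ⁆) u q)
  Reach-avoiding-leaf leaf (here _) u≢x = (λ _ → here (≢⇒∈∁⁅⁆ u≢x)) , (λ u≡x → ⊥-elim (u≢x u≡x))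
  Reach-avoiding-leaf {x} leaf (step {v} {w} walk vw _) u≢x with Reach-avoiding-leaf leaf walk u≢x | w Fin.≟ x
  ... | ih | yes refl = (λ x≢x → ⊥-elim (x≢x refl)) , (λ _ → v , vw , proj₁ ih (Adj⇒≢ vw))
  ... | ih | no  w≢x  = (λ _ → avoiding) , (λ w≡x → ⊥-elim (w≢x w≡x))
    where
    avoiding : Reach G (∁ ⁅ x ⁆) _ w
    avoiding with v Fin.≟ x
    ... | no  v≢x = step (proj₁ ih v≢x) vw (≢⇒∈∁⁅⁆ w≢x)
    ... | yes refl with proj₂ ih refl
    ... | q , qx , walk′ = subst (Reach G (∁ ⁅ x ⁆) _) (leaf⇒Adj-unique leaf (Adj-sym qx) vw) walk′

  Connected⇒InducesConnected-∁-leaf : ∀ {x} → Connected G → IsLeaf G x → InducesConnected G (∁ ⁅ x ⁆)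
  Connected⇒InducesConnected-∁-leaf connected leaf u v u∈ v∈ =
    proj₁ (Reach-avoiding-leaf leaf (connected u v) (∈∁⁅⁆⇒≢ u∈)) (∈∁⁅⁆⇒≢ v∈)

  -- A neighbour of the head further along the path would close a cycle.
  closed-head⇒leaf : ¬ HasCycle G → ∀ {h h₂ rest} → Unique (h ∷ h₂ ∷ rest) → Linked (Adj G) (h ∷ h₂ ∷ rest) →
                     (∀ {u} → Adj G h u → u ∈ h ∷ h₂ ∷ rest) → IsLeaf G h
  closed-head⇒leaf acyclic {h} {h₂} {rest} unique linked closed =
    Adj-unique⇒leaf λ ha hb → trans (next ha) (sym (next hb))
    where
    next : ∀ {u} → Adj G h u → u ≡ h₂
    next {u} hu with closed hu
    ... | here u≡h = ⊥-elim (Adj⇒≢ hu (sym u≡h))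
    ... | there (here u≡h₂) = u≡h₂
    ... | there (there u∈rest) with ∈-∃++ u∈rest
    ... | pre , post , refl = ⊥-elim (acyclic (h , h₂ ∷ pre , u , s≤s z≤n , unique′ , linked′ , Adj-sym hu))
      where
      reassoc : ∀ {P : List (Fin n) → Set} → P (h ∷ h₂ ∷ pre ++ [ u ] ++ post) → P ((h ∷ h₂ ∷ pre ++ [ u ]) ++ post)
      reassoc {P} = subst (λ l → P (h ∷ h₂ ∷ l)) (sym (++-assoc pre [ u ] post))
      unique′ : Unique (h ∷ h₂ ∷ pre ++ [ u ])
      unique′ = Unique-++⁻ˡ (h ∷ h₂ ∷ pre ++ [ u ]) (reassoc {Unique} unique)
      linked′ : Linked (Adj G) (h ∷ h₂ ∷ pre ++ [ u ])
      linked′ = Linked-++⁻ˡ (h ∷ h₂ ∷ pre ++ [ u ]) (reassoc {Linked (Adj G)} linked)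

  record LeafExtension (h : Fin n) (p : List (Fin n)) : Set where
    field
      leaf next : Fin n
      rest      : List (Fin n)
      unique    : Unique (leaf ∷ next ∷ rest)
      linked    : Linked (Adj G) (leaf ∷ next ∷ rest)
      isLeaf    : IsLeaf G leaf
      ⊇p        : p ⊆ leaf ∷ next ∷ rest
      leaf-new  : leaf ≡ h ⊎ leaf ∉ p

  opaque
    -- The fuel bounds the number of vertices still off the path.
    extend-to-leaf′ : ¬ HasCycle G → (fuel : ℕ) → ∀ h h₂ rest → Unique (h ∷ h₂ ∷ rest) →
                      Linked (Adj G) (h ∷ h₂ ∷ rest) → n ≤ fuel + length (h ∷ h₂ ∷ rest) →
                      LeafExtension h (h ∷ h₂ ∷ rest)
    extend-to-leaf′ acyclic fuel h h₂ rest unique linked bound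
      with Fin.any? (λ y → (E G h y Bool.≟ true) ×-dec ¬? (y ∈? h ∷ h₂ ∷ rest))
    ... | no ¬fresh = record
      { leaf = h ; next = h₂ ; rest = rest ; unique = unique ; linked = linked
      ; isLeaf = closed-head⇒leaf acyclic unique linked closed ; ⊇p = λ a∈ → a∈ ; leaf-new = inj₁ refl }
      where
      closed : ∀ {u} → Adj G h u → u ∈ h ∷ h₂ ∷ rest
      closed {u} hu with u ∈? h ∷ h₂ ∷ rest
      ... | yes u∈ = u∈
      ... | no  u∉ = ⊥-elim (¬fresh (u , hu , u∉))
    ... | yes (y , hy , y∉) with fuel
    ...   | zero = ⊥-elim (1+n≰n (≤-trans (Unique⇒length≤ (¬Any⇒All¬ _ y∉ ∷ unique)) bound))
    ...   | suc fuel′ = record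
      { leaf = leaf ; next = next ; rest = rest′ ; unique = unique′ ; linked = linked′ ; isLeaf = isLeaf
      ; ⊇p = ⊇p ∘ there ; leaf-new = inj₂ (new leaf-new) }
      where
      open LeafExtension (extend-to-leaf′ acyclic fuel′ y h (h₂ ∷ rest) (¬Any⇒All¬ _ y∉ ∷ unique) (Adj-sym hy ∷ linked)
                            (subst (n ≤_) (sym (+-suc fuel′ _)) bound))
        renaming (rest to rest′; unique to unique′; linked to linked′)
      new : leaf ≡ y ⊎ leaf ∉ y ∷ h ∷ h₂ ∷ rest → leaf ∉ h ∷ h₂ ∷ rest
      new (inj₁ leaf≡y) = y∉ ∘ subst (_∈ h ∷ h₂ ∷ rest) leaf≡y
      new (inj₂ leaf∉) = leaf∉ ∘ there

    extend-to-leaf : ¬ HasCycle G → ∀ {h h₂ rest} → Unique (h ∷ h₂ ∷ rest) → Linked (Adj G) (h ∷ h₂ ∷ rest) →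
                     LeafExtension h (h ∷ h₂ ∷ rest)
    extend-to-leaf acyclic {h} {h₂} {rest} unique linked =
      extend-to-leaf′ acyclic n h h₂ rest unique linked (m≤m+n n _)

module _ {n : ℕ} (G : Graph n) where

  ⁅⁆-IsSubtree : ∀ v → IsSubtree G ⁅ v ⁆
  ⁅⁆-IsSubtree v = (v , x∈⁅x⁆ v) , λ a b a∈ b∈ →
    subst₂ (Reach G ⁅ v ⁆) (sym (x∈⁅y⁆⇒x≡y v a∈)) (sym (x∈⁅y⁆⇒x≡y v b∈)) (here (x∈⁅x⁆ v))

  ⊤-IsSubtree : Connected G → Fin n → IsSubtree G ⊤
  ⊤-IsSubtree connected v = (v , ∈⊤) , λ a b _ _ → connected a b

  ∁⁅leaf⁆-IsSubtree : ∀ {x y} → Connected G → IsLeaf G x → y ≢ x → IsSubtree G (∁ ⁅ x ⁆)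
  ∁⁅leaf⁆-IsSubtree connected leaf y≢x = (_ , ≢⇒∈∁⁅⁆ y≢x) , Connected⇒InducesConnected-∁-leaf G connected leaf

record LeafPath {n : ℕ} (G : Graph n) : Set where
  field
    x z        : Fin n
    x≢z        : x ≢ z
    x-leaf     : IsLeaf G x
    z-leaf     : IsLeaf G z
    path       : List (Fin n)
    unique     : Unique path
    linked     : Linked (Adj G) path
    x∈path     : x ∈ path
    z∈path     : z ∈ path
    x-nbr∈path : ∀ {u} → Adj G x u → u ∈ path
    z-nbr∈path : ∀ {u} → Adj G z u → u ∈ path

opaque
  -- Extend an edge to a leaf x, then extend the edge at x to a second leaf z.
  leafPath : ∀ {m} (T : Graph (2 + m)) → IsTree T → LeafPath T
  leafPath {m} T (_ , connected , acyclic) = record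
    { x = x ; z = z ; x≢z = x≢z ; x-leaf = isLeaf first ; z-leaf = isLeaf second
    ; path = z ∷ next second ∷ rest second ; unique = unique second ; linked = linked second
    ; x∈path = ⊇p second (there (here refl)) ; z∈path = here refl
    ; x-nbr∈path = λ xu → subst (_∈ _) (sym (leaf⇒Adj-unique T (isLeaf first) xu xx₂)) (⊇p second (here refl))
    ; z-nbr∈path = λ zu → subst (_∈ _) (sym (leaf⇒Adj-unique T (isLeaf second) zu (head-Adj (linked second))))
                                         (there (here refl)) }
    where
    open LeafExtension
    edge-path : ∀ {u v} → Adj T u v → Unique (u ∷ v ∷ []) × Linked (Adj T) (u ∷ v ∷ [])
    edge-path uv = ((Adj⇒≢ T uv ∷ []) ∷ [] ∷ []) , (uv ∷ [-])
    head-Adj : ∀ {u v rest} → Linked (Adj T) (u ∷ v ∷ rest) → Adj T u v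
    head-Adj (uv ∷ _) = uv
    edge-at-1 : ∃ λ v → Adj T v (suc zero)
    edge-at-1 = Reach⇒Adj-last T (connected zero (suc zero)) (λ ())
    first : LeafExtension T (suc zero) (suc zero ∷ proj₁ edge-at-1 ∷ [])
    first = uncurry (extend-to-leaf T acyclic) (edge-path (Adj-sym T (proj₂ edge-at-1)))
    x x₂ : Fin (2 + m)
    x  = leaf first
    x₂ = next first
    xx₂ : Adj T x x₂
    xx₂ = head-Adj (linked first)
    second : LeafExtension T x₂ (x₂ ∷ x ∷ [])
    second = uncurry (extend-to-leaf T acyclic) (edge-path (Adj-sym T xx₂))
    z : Fin (2 + m)
    z = leaf second
    x≢z : x ≢ z
    x≢z x≡z with leaf-new second
    ... | inj₁ z≡x₂ = Adj⇒≢ T xx₂ (trans x≡z z≡x₂)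
    ... | inj₂ z∉   = z∉ (there (here (sym x≡z)))

-- Recognising P4

chord-free : ∀ {n} (G : Graph n) → ¬ HasCycle G → ∀ {v ws w} → 1 ≤ length ws →
             Unique (v ∷ ws ++ [ w ]) → Linked (Adj G) (v ∷ ws ++ [ w ]) → E G w v ≡ false
chord-free G acyclic {v} {ws} {w} 1≤ws unique linked = ¬-not λ wv → acyclic (v , ws , w , 1≤ws , unique , linked , wv)

covering-path⇒P4 : (T : Graph 4) → ¬ HasCycle T → ∀ {Q} → Unique Q → Linked (Adj T) Q →
                   (∀ w → w ∈ Q) → Isomorphic T P4
covering-path⇒P4 T acyclic {Q} unique linked cover = path₄ Q unique linked cover (Unique-covering⇒length≡ unique cover)
  where
  path₄ : ∀ Q → Unique Q → Linked (Adj T) Q → (∀ w → w ∈ Q) → length Q ≡ 4 → Isomorphic T P4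
  path₄ (a ∷ b ∷ c ∷ d ∷ []) U@(_ ∷ U-bcd) L@(ab ∷ L-bcd@(bc ∷ cd ∷ [-])) cover refl =
    mk↔ₛ′ to from to∘from from∘to , λ u v → trans (cong₂ (E T) (sym (from∘to u)) (sym (from∘to v))) (edges (to u) (to v))
    where
    from : Fin 4 → Fin 4
    from = lookup (a ∷ b ∷ c ∷ d ∷ [])
    to : Fin 4 → Fin 4
    to w = index (cover w)
    from∘to : ∀ w → from (to w) ≡ w
    from∘to w = sym (lookup-index (cover w))
    to∘from : ∀ i → to (from i) ≡ i
    to∘from i = Unique⇒lookup-injective U (from∘to (from i))
    ca : E T c a ≡ false
    ca = chord-free T acyclic {ws = b ∷ []} (s≤s z≤n) (Unique-++⁻ˡ (a ∷ b ∷ c ∷ []) U) (Linked-++⁻ˡ (a ∷ b ∷ c ∷ []) L)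
    db : E T d b ≡ false
    db = chord-free T acyclic {ws = c ∷ []} (s≤s z≤n) U-bcd L-bcd
    da : E T d a ≡ false
    da = chord-free T acyclic {ws = b ∷ c ∷ []} (s≤s z≤n) U L
    flip : ∀ {u v} → E T u v ≡ false → E T v u ≡ false
    flip {u} {v} = trans (Graph.sym T v u)
    edges : ∀ i j → E T (from i) (from j) ≡ E P4 i j
    edges 0F 0F = irrefl T a
    edges 0F 1F = ab
    edges 0F 2F = flip ca
    edges 0F 3F = flip da
    edges 1F 0F = Adj-sym T ab
    edges 1F 1F = irrefl T b
    edges 1F 2F = bc
    edges 1F 3F = flip db
    edges 2F 0F = ca
    edges 2F 1F = Adj-sym T bc
    edges 2F 2F = irrefl T c
    edges 2F 3F = cd
    edges 3F 0F = da
    edges 3F 1F = db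
    edges 3F 2F = Adj-sym T cd
    edges 3F 3F = irrefl T d
  path₄ []                        _ _ _ ()
  path₄ (_ ∷ [])                  _ _ _ ()
  path₄ (_ ∷ _ ∷ [])              _ _ _ ()
  path₄ (_ ∷ _ ∷ _ ∷ [])          _ _ _ ()
  path₄ (_ ∷ _ ∷ _ ∷ _ ∷ _ ∷ _)   _ _ _ ()

-- A vertex w off the path with two neighbours a ≠ b would make a, b, w, x, z five distinct vertices.
two-leaves⇒P4 : ∀ {n} (T : Graph n) → n ≡ 4 → ¬ HasCycle T → (lp : LeafPath T) →
                (∀ {w} → IsLeaf T w → w ≡ LeafPath.x lp ⊎ w ≡ LeafPath.z lp) → Isomorphic T P4
two-leaves⇒P4 T refl acyclic lp only-leaves = covering-path⇒P4 T acyclic unique linked on-path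
  where
  open LeafPath lp
  open import Data.List.Membership.DecPropositional (Fin._≟_ {4}) using (_∈?_)
  off-path⇒leaf : ∀ {w} → w ∉ path → IsLeaf T w
  off-path⇒leaf {w} w∉ = Adj-unique⇒leaf T at-most-one
    where
    ≢w : ∀ {c} → Adj T w c → c ≢ w
    ≢w wc = Adj⇒≢ T wc ∘ sym
    ≢x : ∀ {c} → Adj T w c → c ≢ x
    ≢x wc refl = w∉ (x-nbr∈path (Adj-sym T wc))
    ≢z : ∀ {c} → Adj T w c → c ≢ z
    ≢z wc refl = w∉ (z-nbr∈path (Adj-sym T wc))
    w≢x : w ≢ x
    w≢x refl = w∉ x∈path
    w≢z : w ≢ z
    w≢z refl = w∉ z∈path
    at-most-one : ∀ {a b} → Adj T w a → Adj T w b → a ≡ b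
    at-most-one {a} {b} wa wb with a Fin.≟ b
    ... | yes a≡b = a≡b
    ... | no  a≢b = ⊥-elim (1+n≰n (Unique⇒length≤
            ((a≢b ∷ ≢w wa ∷ ≢x wa ∷ ≢z wa ∷ []) ∷ (≢w wb ∷ ≢x wb ∷ ≢z wb ∷ []) ∷ (w≢x ∷ w≢z ∷ []) ∷ (x≢z ∷ []) ∷ [] ∷ [])))
  on-path : ∀ w → w ∈ path
  on-path w with w ∈? path
  ... | yes w∈ = w∈
  ... | no  w∉ with only-leaves (off-path⇒leaf w∉)
  ...   | inj₁ refl = ⊥-elim (w∉ x∈path)
  ...   | inj₂ refl = ⊥-elim (w∉ z∈path)

-- Averages

/-mono-cross : ∀ a b c d → a * suc d ≤ c * suc b → ℤ.+ a / suc b ≤ℚ ℤ.+ c / suc d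
/-mono-cross a b c d ad≤cb = ℚ.toℚᵘ-cancel-≤
  (ℚᵘ.≤-respˡ-≃ (ℚᵘ.≃-sym (ℚ.toℚᵘ-fromℚᵘ (mkℚᵘ (ℤ.+ a) b)))
  (ℚᵘ.≤-respʳ-≃ (ℚᵘ.≃-sym (ℚ.toℚᵘ-fromℚᵘ (mkℚᵘ (ℤ.+ c) d)))
  (*≤* (subst₂ ℤ._≤_ (ℤ.pos-* a (suc d)) (ℤ.pos-* c (suc b)) (ℤ.+≤+ ad≤cb)))))

average-mono : ∀ {xs ys} → xs ≢ [] → ys ≢ [] → sum xs * length ys ≤ sum ys * length xs →
               average xs ≤ℚ average ys
average-mono {[]}     xs≢[] _     _     = ⊥-elim (xs≢[] refl)
average-mono {_ ∷ _}  {[]}  _     ys≢[] _ = ⊥-elim (ys≢[] refl)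
average-mono {x ∷ xs} {y ∷ ys} _  _     = /-mono-cross (sum (x ∷ xs)) (length xs) (sum (y ∷ ys)) (length ys)

average-injective : ∀ {xs ys} → xs ≢ [] → ys ≢ [] → average xs ≡ average ys →
                    sum xs * length ys ≡ sum ys * length xs
average-injective {[]}     xs≢[] _     _     = ⊥-elim (xs≢[] refl)
average-injective {_ ∷ _}  {[]}  _     ys≢[] _ = ⊥-elim (ys≢[] refl)
average-injective {x ∷ xs} {y ∷ ys} _  _     = ℚ.normalize-injective-≃ (sum (x ∷ xs)) (sum (y ∷ ys)) _ _

-- For k = 2 + k′ and t = 2 + 2r + t′ the gap t (k + r) − (k + t)(1 + r) is t′ + k′ (1 + r + t′).
cross-gap : ∀ k′ r t′ → (2 + k′ + (2 + 2 * r + t′)) * suc r + (t′ + k′ * (suc r + t′)) ≡ (2 + 2 * r + t′) * (2 + k′ + r)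
cross-gap = solve-∀

cross-≤ : ∀ {k r t} → 2 ≤ k → 2 + 2 * r ≤ t → (k + t) * suc r ≤ t * (k + r)
cross-≤ {r = r} 2≤k 2+2r≤t with m≤n⇒∃[o]m+o≡n 2≤k | m≤n⇒∃[o]m+o≡n 2+2r≤t
... | k′ , refl | t′ , refl = ≤-trans (m≤m+n _ _) (≤-reflexive (cross-gap k′ r t′))

cross-≡ : ∀ {k r t} → 2 ≤ k → 2 + 2 * r ≤ t → (k + t) * suc r ≡ t * (k + r) → k ≡ 2 × t ≡ 2 + 2 * r
cross-≡ {r = r} 2≤k 2+2r≤t eq with m≤n⇒∃[o]m+o≡n 2≤k | m≤n⇒∃[o]m+o≡n 2+2r≤t
... | k′ , refl | t′ , refl = cong (2 +_) k′≡0 , trans (cong (2 + 2 * r +_) t′≡0) (+-identityʳ _)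
  where
  gap≡0 : t′ + k′ * (suc r + t′) ≡ 0
  gap≡0 = +-cancelˡ-≡ _ _ _ (trans (cross-gap k′ r t′) (trans (sym eq) (sym (+-identityʳ _))))
  t′≡0 : t′ ≡ 0
  t′≡0 = m+n≡0⇒m≡0 t′ gap≡0
  k′≡0 : k′ ≡ 0
  k′≡0 = m*n≡0⇒m≡0 k′ (suc r + t′) (m+n≡0⇒n≡0 t′ gap≡0)

-- Counting the subtrees of a tree

sizes : ∀ {n} → List (Subset n) → List ℕ
sizes = map ∣_∣

module SubtreeCounts {m : ℕ} (T : Graph (3 + m)) (tree : IsTree T) {L L' : List (Subset (3 + m))}
                     (enum : Enumerates L (IsSubtree T)) (enum' : Enumerates L' (IsSubtree' T)) where

  n : ℕ
  n = 3 + m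

  connected : Connected T
  connected = proj₁ (proj₂ tree)

  leaves : LeafPath T
  leaves = leafPath T tree

  open LeafPath leaves using (x; z; x≢z; x-leaf; z-leaf)

  ∈L⇒IsSubtree : ∀ {S} → S ∈ L → IsSubtree T S
  ∈L⇒IsSubtree {S} = proj₁ (proj₂ enum S)

  IsSubtree⇒∈L : ∀ {S} → IsSubtree T S → S ∈ L
  IsSubtree⇒∈L {S} = proj₂ (proj₂ enum S)

  LeafSingleton : Subset n → Set
  LeafSingleton S = Σ (Fin n) λ v → IsLeaf T v × S ≡ ⁅ v ⁆

  leafSingleton? : Decidable LeafSingleton
  leafSingleton? S = Fin.any? λ v → (degree T v ℕ.≤? 1) ×-dec (≡-dec Bool._≟_ S ⁅ v ⁆)

  K R : List (Subset n)
  K = filter leafSingleton? L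
  R = filter (∁? leafSingleton?) L

  k r t : ℕ
  k = length K
  r = length R
  t = sum (sizes R)

  ∈R⁻ : ∀ {S} → S ∈ R → S ∈ L × ¬ LeafSingleton S
  ∈R⁻ = ∈-filter⁻ (∁? leafSingleton?) {xs = L}

  L'↭∅∷R : L' ↭ ∅ ∷ R
  L'↭∅∷R = ∼bag⇒↭ (unique∧set⇒bag (proj₁ enum') unique-∅∷R (mk⇔ to from))
    where
    ∅∉R : ∅ ∉ R
    ∅∉R ∅∈R = ∉⊥ (proj₂ (proj₁ (∈L⇒IsSubtree (proj₁ (∈R⁻ ∅∈R)))))
    unique-∅∷R : Unique (∅ ∷ R)
    unique-∅∷R = ¬Any⇒All¬ R ∅∉R ∷ filter⁺ (∁? leafSingleton?) (proj₁ enum)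
    to : ∀ {S} → S ∈ L' → S ∈ ∅ ∷ R
    to {S} S∈L' with proj₁ (proj₂ enum' S) S∈L'
    ... | inj₁ S≡∅ , _         = here S≡∅
    ... | inj₂ subtree , ¬leaf = there (∈-filter⁺ (∁? leafSingleton?) (IsSubtree⇒∈L subtree) ¬leaf)
    from : ∀ {S} → S ∈ ∅ ∷ R → S ∈ L'
    from (here refl) = proj₂ (proj₂ enum' ∅) (inj₁ refl , λ (v , _ , ∅≡⁅v⁆) → ∉⊥ (subst (v ∈ₛ_) (sym ∅≡⁅v⁆) (x∈⁅x⁆ v)))
    from {S} (there S∈R) = proj₂ (proj₂ enum' S) (inj₂ (∈L⇒IsSubtree (proj₁ (∈R⁻ S∈R))) , proj₂ (∈R⁻ S∈R))

  length-sizes-L : length (sizes L) ≡ k + r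
  length-sizes-L = trans (length-map ∣_∣ L) (trans (↭-length (↭-filter-∁ leafSingleton? L)) (length-++ K))

  sum-sizes-L : sum (sizes L) ≡ k + t
  sum-sizes-L = begin
    sum (sizes L)                    ≡⟨ sum-↭ (map⁺ ∣_∣ (↭-filter-∁ leafSingleton? L)) ⟩
    sum (sizes (K ++ R))             ≡⟨ sum-map-++ ∣_∣ K R ⟩
    sum (sizes K) + t                ≡⟨ cong (_+ t) (sum-map-const ∣_∣ K ∣S∣≡1) ⟩
    k * 1 + t                        ≡⟨ cong (_+ t) (*-identityʳ k) ⟩
    k + t                            ∎
    where
    open ≡-Reasoning
    ∣S∣≡1 : ∀ {S} → S ∈ K → ∣ S ∣ ≡ 1
    ∣S∣≡1 S∈K with ∈-filter⁻ leafSingleton? {xs = L} S∈K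
    ... | _ , (v , _ , refl) = ∣⁅x⁆∣≡1 v

  length-sizes-L' : length (sizes L') ≡ suc r
  length-sizes-L' = trans (length-map ∣_∣ L') (↭-length L'↭∅∷R)

  sum-sizes-L' : sum (sizes L') ≡ t
  sum-sizes-L' = trans (sum-↭ (map⁺ ∣_∣ L'↭∅∷R)) (cong (_+ t) (∣⊥∣≡0 n))

  distinct-leaves≤k : ∀ {vs} → Unique vs → (∀ {v} → v ∈ vs → IsLeaf T v) → length vs ≤ k
  distinct-leaves≤k {vs} unique leaf = subst (_≤ k) (length-map ⁅_⁆ vs)
    (Unique⇒length-mono (Unique.map⁺ ⁅⁆-injective unique) λ S∈ → case ∈-map⁻ ⁅_⁆ S∈ of λ where
      (v , v∈ , refl) → ∈-filter⁺ leafSingleton? (IsSubtree⇒∈L (⁅⁆-IsSubtree T v)) (v , leaf v∈ , refl))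

  2≤k : 2 ≤ k
  2≤k = distinct-leaves≤k ((x≢z ∷ []) ∷ [] ∷ []) λ where
    (here refl)         → x-leaf
    (there (here refl)) → z-leaf

  k≡2⇒leaf≡x⊎z : k ≡ 2 → ∀ {w} → IsLeaf T w → w ≡ x ⊎ w ≡ z
  k≡2⇒leaf≡x⊎z k≡2 {w} w-leaf with w Fin.≟ x | w Fin.≟ z
  ... | yes w≡x | _       = inj₁ w≡x
  ... | no  _   | yes w≡z = inj₂ w≡z
  ... | no  w≢x | no  w≢z = ⊥-elim (1+n≰n (subst (3 ≤_) k≡2 (distinct-leaves≤k
          ((w≢x ∷ w≢z ∷ []) ∷ (x≢z ∷ []) ∷ [] ∷ []) λ where
            (here refl)                 → w-leaf
            (there (here refl))         → x-leaf
            (there (there (here refl))) → z-leaf)))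

  size1? : Decidable (λ (S : Subset n) → ∣ S ∣ ≡ 1)
  size1? S = ∣ S ∣ ℕ.≟ 1

  R₁ R₂ : List (Subset n)
  R₁ = filter size1? R
  R₂ = filter (∁? size1?) R

  r₁ r₂ : ℕ
  r₁ = length R₁
  r₂ = length R₂

  excess : Subset n → ℕ
  excess S = ∣ S ∣ ∸ 2

  r≡r₁+r₂ : r ≡ r₁ + r₂
  r≡r₁+r₂ = trans (↭-length (↭-filter-∁ size1? R)) (length-++ R₁)

  t≡r₁+sizes-R₂ : t ≡ r₁ + sum (sizes R₂)
  t≡r₁+sizes-R₂ = begin
    t                                  ≡⟨ sum-↭ (map⁺ ∣_∣ (↭-filter-∁ size1? R)) ⟩
    sum (sizes (R₁ ++ R₂))             ≡⟨ sum-map-++ ∣_∣ R₁ R₂ ⟩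
    sum (sizes R₁) + sum (sizes R₂)    ≡⟨ cong (_+ sum (sizes R₂)) (sum-map-const ∣_∣ R₁ (proj₂ ∘ ∈-filter⁻ size1? {xs = R})) ⟩
    r₁ * 1 + sum (sizes R₂)            ≡⟨ cong (_+ sum (sizes R₂)) (*-identityʳ r₁) ⟩
    r₁ + sum (sizes R₂)                ∎
    where open ≡-Reasoning

  -- R₁ holds the singletons of non-leaves, so ⁅ x ⁆, ⁅ z ⁆ and R₁ are distinct singletons.
  2+r₁≤n : 2 + r₁ ≤ n
  2+r₁≤n = Unique-singletons⇒length≤ unique size1
    where
    ⁅leaf⁆∉R₁ : ∀ {v} → IsLeaf T v → ⁅ v ⁆ ∉ R₁
    ⁅leaf⁆∉R₁ {v} leaf ⁅v⁆∈R₁ = proj₂ (∈R⁻ (proj₁ (∈-filter⁻ size1? {xs = R} ⁅v⁆∈R₁))) (v , leaf , refl)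
    unique : Unique (⁅ x ⁆ ∷ ⁅ z ⁆ ∷ R₁)
    unique = (x≢z ∘ ⁅⁆-injective ∷ ¬Any⇒All¬ R₁ (⁅leaf⁆∉R₁ x-leaf)) ∷ ¬Any⇒All¬ R₁ (⁅leaf⁆∉R₁ z-leaf)
           ∷ filter⁺ size1? (filter⁺ (∁? leafSingleton?) (proj₁ enum))
    size1 : ∀ {S} → S ∈ ⁅ x ⁆ ∷ ⁅ z ⁆ ∷ R₁ → ∣ S ∣ ≡ 1
    size1 (here refl)          = ∣⁅x⁆∣≡1 x
    size1 (there (here refl))  = ∣⁅x⁆∣≡1 z
    size1 (there (there S∈R₁)) = proj₂ (∈-filter⁻ size1? {xs = R} S∈R₁)

  ∈R₂⇒2≤∣S∣ : ∀ {S} → S ∈ R₂ → 2 ≤ ∣ S ∣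
  ∈R₂⇒2≤∣S∣ S∈R₂ with ∈-filter⁻ (∁? size1?) {xs = R} S∈R₂
  ... | S∈R , ∣S∣≢1 = ≤∧≢⇒< (∈⇒1≤∣p∣ (proj₂ (proj₁ (∈L⇒IsSubtree (proj₁ (∈R⁻ S∈R)))))) (∣S∣≢1 ∘ sym)

  -- T, T − x and T − z are three distinct members of R₂, of sizes n, n − 1 and n − 1.
  3m+1≤excess-R₂ : suc (3 * m) ≤ sum (map excess R₂)
  3m+1≤excess-R₂ = subst (_≤ sum (map excess R₂)) excess-⊤∁x∁z (Unique⇒sum-map-mono excess unique ⊆R₂)
    where
    ∣∁⁅_⁆∣ : ∀ v → ∣ ∁ ⁅ v ⁆ ∣ ≡ 2 + m
    ∣∁⁅ v ⁆∣ = trans (∣∁p∣≡n∸∣p∣ ⁅ v ⁆) (cong (n ∸_) (∣⁅x⁆∣≡1 v))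
    unique : Unique (⊤ ∷ ∁ ⁅ x ⁆ ∷ ∁ ⁅ z ⁆ ∷ [])
    unique = (⊤≢∁⁅x⁆ ∷ ⊤≢∁⁅x⁆ ∷ []) ∷ ((x≢z ∘ ∁⁅⁆-injective) ∷ []) ∷ [] ∷ []
    ∈R₂ : ∀ {S} → IsSubtree T S → ∣ S ∣ ≢ 1 → S ∈ R₂
    ∈R₂ subtree ∣S∣≢1 = ∈-filter⁺ (∁? size1?)
      (∈-filter⁺ (∁? leafSingleton?) (IsSubtree⇒∈L subtree) λ (v , _ , S≡⁅v⁆) → ∣S∣≢1 (trans (cong ∣_∣ S≡⁅v⁆) (∣⁅x⁆∣≡1 v)))
      ∣S∣≢1
    ⊆R₂ : ∀ {S} → S ∈ ⊤ ∷ ∁ ⁅ x ⁆ ∷ ∁ ⁅ z ⁆ ∷ [] → S ∈ R₂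
    ⊆R₂ (here refl) = ∈R₂ (⊤-IsSubtree T connected x) λ ∣⊤∣≡1 → case trans (sym (∣⊤∣≡n n)) ∣⊤∣≡1 of λ ()
    ⊆R₂ (there (here refl)) =
      ∈R₂ (∁⁅leaf⁆-IsSubtree T connected x-leaf (x≢z ∘ sym)) λ ∣∁⁅x⁆∣≡1 → case trans (sym ∣∁⁅ x ⁆∣) ∣∁⁅x⁆∣≡1 of λ ()
    ⊆R₂ (there (there (here refl))) =
      ∈R₂ (∁⁅leaf⁆-IsSubtree T connected z-leaf x≢z) λ ∣∁⁅z⁆∣≡1 → case trans (sym ∣∁⁅ z ⁆∣) ∣∁⁅z⁆∣≡1 of λ ()
    excess-⊤∁x∁z : excess ⊤ + (excess (∁ ⁅ x ⁆) + (excess (∁ ⁅ z ⁆) + 0)) ≡ suc (3 * m)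
    excess-⊤∁x∁z = cong₂ _+_ (cong (_∸ 2) (∣⊤∣≡n n)) (cong₂ _+_ (cong (_∸ 2) ∣∁⁅ x ⁆∣) (cong ((_+ 0) ∘ (_∸ 2)) ∣∁⁅ z ⁆∣))

  2r+2m≤t : 2 * r + 2 * m ≤ t
  2r+2m≤t = subst₂ (λ r t → 2 * r + 2 * m ≤ t) (sym r≡r₁+r₂)
              (sym (trans t≡r₁+sizes-R₂ (cong (r₁ +_) (sum-map-∸ ∣_∣ R₂ ∈R₂⇒2≤∣S∣))))
              (count-arith 2+r₁≤n 3m+1≤excess-R₂)
    where
    count-arith : ∀ {r₁ r₂ e} → 2 + r₁ ≤ 3 + m → suc (3 * m) ≤ e → 2 * (r₁ + r₂) + 2 * m ≤ r₁ + (r₂ * 2 + e)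
    count-arith {r₁} {r₂} {e} 2+r₁≤3+m 3m+1≤e = begin
      2 * (r₁ + r₂) + 2 * m         ≡⟨ regroup r₁ r₂ m ⟩
      r₁ + (r₂ * 2 + (r₁ + 2 * m))  ≤⟨ +-monoʳ-≤ r₁ (+-monoʳ-≤ (r₂ * 2) (+-monoˡ-≤ (2 * m) (ℕ.s≤s⁻¹ (ℕ.s≤s⁻¹ 2+r₁≤3+m)))) ⟩
      r₁ + (r₂ * 2 + (suc m + 2 * m)) ≤⟨ +-monoʳ-≤ r₁ (+-monoʳ-≤ (r₂ * 2) 3m+1≤e) ⟩
      r₁ + (r₂ * 2 + e)             ∎
      where
      open ≤-Reasoning
      regroup : ∀ a b c → 2 * (a + b) + 2 * c ≡ a + (b * 2 + (a + 2 * c))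
      regroup = solve-∀

  sizes-L≢[] : sizes L ≢ []
  sizes-L≢[] sizes-L≡[] =
    case ≤-trans 2≤k (≤-trans (m≤m+n k r) (≤-reflexive (trans (sym length-sizes-L) (cong length sizes-L≡[])))) of λ ()

  sizes-L'≢[] : sizes L' ≢ []
  sizes-L'≢[] sizes-L'≡[] = case trans (sym length-sizes-L') (cong length sizes-L'≡[]) of λ ()

lemma3 : ∀ {n : ℕ} (T : Graph n) → IsTree T → 4 ≤ n →
           (L L' : List (Subset n)) →
           Enumerates L (IsSubtree T) → Enumerates L' (IsSubtree' T) →
           (avgSize L ≤ℚ avgSize L') × (avgSize L ≡ avgSize L' → Isomorphic T P4)
lemma3 T tree@(_ , _ , acyclic) (s≤s (s≤s (s≤s (s≤s {n = m} _)))) L L' enum enum' = μ≤μ' , μ≡μ'⇒P4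
  where
  open SubtreeCounts {m = suc m} T tree enum enum'
  cross-L : sum (sizes L) * length (sizes L') ≡ (k + t) * suc r
  cross-L = cong₂ _*_ sum-sizes-L length-sizes-L'
  cross-L' : sum (sizes L') * length (sizes L) ≡ t * (k + r)
  cross-L' = cong₂ _*_ sum-sizes-L' length-sizes-L
  2+2r≤t : 2 + 2 * r ≤ t
  2+2r≤t = ≤-trans (≤-reflexive (+-comm 2 (2 * r))) (≤-trans (+-monoʳ-≤ (2 * r) (*-monoʳ-≤ 2 (s≤s z≤n))) 2r+2m≤t)
  μ≤μ' : avgSize L ≤ℚ avgSize L'
  μ≤μ' = average-mono sizes-L≢[] sizes-L'≢[] (subst₂ _≤_ (sym cross-L) (sym cross-L') (cross-≤ 2≤k 2+2r≤t))
  μ≡μ'⇒P4 : avgSize L ≡ avgSize L' → Isomorphic T P4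
  μ≡μ'⇒P4 μ≡μ' = two-leaves⇒P4 T (cong (4 +_) m≡0) acyclic leaves (k≡2⇒leaf≡x⊎z (proj₁ k≡2×t≡2+2r))
    where
    k≡2×t≡2+2r : k ≡ 2 × t ≡ 2 + 2 * r
    k≡2×t≡2+2r = cross-≡ 2≤k 2+2r≤t (trans (sym cross-L) (trans (average-injective sizes-L≢[] sizes-L'≢[] μ≡μ') cross-L'))
    m≡0 : m ≡ 0
    m≡0 = n≤0⇒n≡0 (ℕ.s≤s⁻¹ (*-cancelˡ-≤ 2 (+-cancelˡ-≤ (2 * r) _ _
            (subst (2 * r + 2 * suc m ≤_) (trans (proj₂ k≡2×t≡2+2r) (+-comm 2 (2 * r))) 2r+2m≤t))))
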